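{- For every positive integer $n$, $$\Phi^{(2)}[a; b, b'; cq^{ -n}, c'; x, y] = \frac{1}{(q/c; q)_n} \sum_{k=0}^n \begin{bmatrix} n \\ k \end{bmatrix} (-c)^{k-n} q^{\binom{n+1-k}{2}} \Phi^{(2)}[a; b, b'; c, c'; xq^k, y],$$ and $$\Phi^{(2)}[a; b, b'; cq^n, c'; x, y] = \sum_{k=0}^n \begin{bmatrix} n \\ k \end{bmatrix} c^k q^{2\binom{k}{2}} (cq^k; q)_{n-k}\, \Phi^{(2)}[a; b, b'; cq^k, c'; xq^k, y].$$
   Context: Let $q$ be a complex number with $|q|<1$. For a complex number $z$ and an integer $N\ge 0$, $(z;q)_N=\prod_{j=0}^{N-1}(1-zq^j)$. The $q$-binomial coefficient is $\begin{bmatrix} n \\ k \end{bmatrix}=\frac{(q;q)_n}{(q;q)_k(q;q)_{n-k}}$ for $0\le k\le n$, and $\binom{k}{2}=k(k-1)/2$. The $q$-Appell function $\Phi^{(2)}$ is $$\Phi^{(2)}[a; b, b'; c, c'; x, y] = \sum_{m, n \geq 0} \frac{(a; q)_{m+n} (b; q)_m (b'; q)_n}{(q; q)_m (q; q)_n (c; q)_m (c'; q)_n} x^m y^n .$$ All identities are understood as identities of power series in $x,y$ (convergent for $|x|,|y|$ sufficiently small), with parameters generic so that no denominator appearing vanishes. -}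

module Defs where

open import Level using (Level; _⊔_)
open import Data.Nat as ℕ using (ℕ; zero; suc; _∸_)
open import Algebra.Bundles using (CommutativeRing)
open import Relation.Nullary using (¬_)

record Field (c ℓ : Level) : Set (Level.suc (c ⊔ ℓ)) where
  field
    commutativeRing : CommutativeRing c ℓ
  open CommutativeRing commutativeRing public
  field
    _⁻¹      : Carrier → Carrier
    ⁻¹-cong  : ∀ {x y} → x ≈ y → x ⁻¹ ≈ y ⁻¹
    inverseʳ : ∀ x → ¬ (x ≈ 0#) → x * (x ⁻¹) ≈ 1#
    0≉1      : ¬ (0# ≈ 1#)

module FieldDefs {c ℓ : Level} (F : Field c ℓ) where
  open Field F hiding (zero)

  infixr 8 _^_
  _^_ : Carrier → ℕ → Carrier
  x ^ zero  = 1#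
  x ^ suc n = x * (x ^ n)

  _/_ : Carrier → Carrier → Carrier
  x / y = x * (y ⁻¹)

  poch : (z q : Carrier) → ℕ → Carrier
  poch z q zero    = 1#
  poch z q (suc N) = poch z q N * (1# - z * (q ^ N))

  -- q-binomial coefficient [n k] = (q;q)_n / ((q;q)_k (q;q)_{n-k})   (used for 0 ≤ k ≤ n)
  qbinom : (q : Carrier) → ℕ → ℕ → Carrier
  qbinom q n k = poch q q n / (poch q q k * poch q q (n ∸ k))

  choose2 : ℕ → ℕ
  choose2 zero    = 0
  choose2 (suc k) = k ℕ.+ choose2 k

  -- formal power series in two variables x, y: coefficient of x^m y^l
  PS : Set c
  PS = ℕ → ℕ → Carrier

  _≈ₚ_ : PS → PS → Set ℓ
  f ≈ₚ g = ∀ m l → f m l ≈ g m l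

  _·ₚ_ : Carrier → PS → PS
  (s ·ₚ f) m l = s * f m l

  sumₚ : ℕ → (ℕ → PS) → PS
  sumₚ zero    f m l = f zero m l
  sumₚ (suc n) f m l = sumₚ n f m l + f (suc n) m l

  -- substitution x ↦ s x in a series:  f(s x, y)
  scaleX : Carrier → PS → PS
  scaleX s f m l = (s ^ m) * f m l

  Φ2 : (q a b b' c₁ c₁' : Carrier) → PS
  Φ2 q a b b' c₁ c₁' m l =
    (poch a q (m ℕ.+ l) * poch b q m * poch b' q l)
      / (poch q q m * poch q q l * poch c₁ q m * poch c₁' q l)

-- Both sides are compared coefficientwise.  The coefficient of xᵐ yˡ of
-- Φ⁽²⁾[a; b, b'; c, c'; x, y] is  W(m,l) / (c;q)ₘ  with W independent of c,
-- and the substitution x ↦ qᵏ x multiplies it by (qᵏ)ᵐ.  After factoring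
-- out W, each identity becomes a finite identity between scalars:
--
--  * c ↦ c qⁿ :  Σₖ [n k] zᵏ q^{2(k choose 2)} (z qᵏ;q)_{n-k} = 1 (z = c qᵐ),
--    together with (c qᵏ;q)_{n-k} (c qⁿ;q)ₘ = (c qᵏ;q)ₘ (z qᵏ;q)_{n-k};
--  * c ↦ c q⁻ⁿ : the q-binomial theorem
--    Σₖ [n k] e^{n-k} q^{(n+1-k choose 2)} wᵏ = ∏_{j=1}^{n} (w + e qʲ)
--    with e = -1/c, w = qᵐ, and the reflection formula
--    (c;q)ₘ (q/c;q)ₙ = (c q⁻ⁿ;q)ₘ ∏_{j=1}^{n} (qᵐ - qʲ/c).
--
-- The Gaussian coefficients are handled through the Pascal recurrence
-- [k+r+2 k+1] = q^{k+1} [k+r+1 k+1] + [k+r+1 k]; both finite identities then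
-- follow by induction on n from one Pascal-summation lemma for sums over the
-- antidiagonal k + r = n.

module Submission where

open import Defs
open import Level using (Level)
open import Data.Nat using (ℕ; _≤_; _∸_) renaming (_+_ to _+ℕ_; _*_ to _*ℕ_)
open import Data.Product using (_×_; _,_)
open import Relation.Nullary using (¬_)

open import Data.Nat as ℕ using (zero; suc)
import Data.Nat.Properties as ℕP
open import Data.Integer as ℤ using (ℤ; +_; -[1+_])
import Data.Integer.Properties as ℤP
open import Data.Sign as Sign using (Sign)
open import Data.Maybe using (Maybe; just; nothing)
open import Relation.Nullary using (yes; no)
open import Relation.Binary.PropositionalEquality as PE using (_≡_)
open import Algebra.Bundles using (CommutativeRing)
open import Algebra.Solver.Ring.AlmostCommutativeRing
  using (AlmostCommutativeRing; fromCommutativeRing; _-Raw-AlmostCommutative⟶_)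

module IntegerCoefficients {c ℓ : Level} (R : CommutativeRing c ℓ) where
  open CommutativeRing R
  open import Algebra.Properties.Ring ring using (-‿distribʳ-*; -1*x≈-x)
  open import Algebra.Properties.AbelianGroup +-abelianGroup using (⁻¹-∙-comm)
  open import Algebra.Properties.Group +-group using (⁻¹-involutive; ε⁻¹≈ε)
  open import Algebra.Properties.CommutativeSemigroup *-commutativeSemigroup using (interchange)
  open import Algebra.Properties.Semiring.Mult.TCOptimised semiring using (×-homo-+; ×1-homo-*) renaming (_×_ to _·ℕ_)
  open import Relation.Binary.Reasoning.Setoid setoid

  ⟦_⟧ℕ : ℕ → Carrier
  ⟦ n ⟧ℕ = n ·ℕ 1#

  ⟦_⟧ℤ : ℤ → Carrier
  ⟦ + n ⟧ℤ      = ⟦ n ⟧ℕ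
  ⟦ -[1+ n ] ⟧ℤ = - ⟦ suc n ⟧ℕ

  neg-homo : ∀ i → ⟦ ℤ.- i ⟧ℤ ≈ - ⟦ i ⟧ℤ
  neg-homo -[1+ n ]  = sym (⁻¹-involutive _)
  neg-homo (+ zero)  = sym ε⁻¹≈ε
  neg-homo (+ suc n) = refl

  shift-difference : ∀ x y → (1# + x) - (1# + y) ≈ x - y
  shift-difference x y = begin
    (1# + x) + - (1# + y)      ≈⟨ +-congˡ (sym (⁻¹-∙-comm 1# y)) ⟩
    (1# + x) + (- 1# + - y)    ≈⟨ +-assoc _ _ _ ⟩
    1# + (x + (- 1# + - y))    ≈⟨ +-congˡ (+-congˡ (+-comm _ _)) ⟩
    1# + (x + (- y + - 1#))    ≈⟨ +-congˡ (sym (+-assoc _ _ _)) ⟩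
    1# + ((x + - y) + - 1#)    ≈⟨ +-congˡ (+-comm _ _) ⟩
    1# + (- 1# + (x + - y))    ≈⟨ sym (+-assoc _ _ _) ⟩
    (1# + - 1#) + (x + - y)    ≈⟨ +-congʳ (-‿inverseʳ 1#) ⟩
    0# + (x + - y)             ≈⟨ +-identityˡ _ ⟩
    x + - y                    ∎

  suc-homo : ∀ n → ⟦ suc n ⟧ℕ ≈ 1# + ⟦ n ⟧ℕ
  suc-homo n = ×-homo-+ 1# 1 n

  ⊖-homo : ∀ m n → ⟦ m ℤ.⊖ n ⟧ℤ ≈ ⟦ m ⟧ℕ - ⟦ n ⟧ℕ
  ⊖-homo m zero = trans (sym (+-identityʳ _)) (+-congˡ (sym ε⁻¹≈ε))
  ⊖-homo zero (suc n) = sym (+-identityˡ _)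
  ⊖-homo (suc m) (suc n) = begin
    ⟦ suc m ℤ.⊖ suc n ⟧ℤ     ≡⟨ PE.cong ⟦_⟧ℤ (ℤP.[1+m]⊖[1+n]≡m⊖n m n) ⟩
    ⟦ m ℤ.⊖ n ⟧ℤ             ≈⟨ ⊖-homo m n ⟩
    ⟦ m ⟧ℕ - ⟦ n ⟧ℕ          ≈⟨ shift-difference _ _ ⟨
    (1# + ⟦ m ⟧ℕ) - (1# + ⟦ n ⟧ℕ) ≈⟨ +-cong (suc-homo m) (-‿cong (suc-homo n)) ⟨
    ⟦ suc m ⟧ℕ - ⟦ suc n ⟧ℕ  ∎

  +-homo : ∀ i j → ⟦ i ℤ.+ j ⟧ℤ ≈ ⟦ i ⟧ℤ + ⟦ j ⟧ℤ
  +-homo -[1+ m ] -[1+ n ] = begin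
    - ⟦ suc (suc (m ℕ.+ n)) ⟧ℕ      ≡⟨ PE.cong (λ t → - ⟦ suc t ⟧ℕ) (ℕP.+-suc m n) ⟨
    - ⟦ suc m ℕ.+ suc n ⟧ℕ          ≈⟨ -‿cong (×-homo-+ 1# (suc m) (suc n)) ⟩
    - (⟦ suc m ⟧ℕ + ⟦ suc n ⟧ℕ)     ≈⟨ ⁻¹-∙-comm _ _ ⟨
    - ⟦ suc m ⟧ℕ + - ⟦ suc n ⟧ℕ     ∎
  +-homo -[1+ m ] (+ n) = trans (⊖-homo n (suc m)) (+-comm _ _)
  +-homo (+ m) -[1+ n ] = ⊖-homo m (suc n)
  +-homo (+ m) (+ n)    = ×-homo-+ 1# m n

  -- multiplication is handled through the sign/absolute-value decomposition
  ⟦_⟧sign : Sign → Carrier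
  ⟦ Sign.+ ⟧sign = 1#
  ⟦ Sign.- ⟧sign = - 1#

  ◃-homo : ∀ s n → ⟦ s ℤ.◃ n ⟧ℤ ≈ ⟦ s ⟧sign * ⟦ n ⟧ℕ
  ◃-homo s zero              = sym (zeroʳ _)
  ◃-homo Sign.+ (suc n)      = sym (*-identityˡ _)
  ◃-homo Sign.- (suc n)      = sym (-1*x≈-x _)

  sign-homo : ∀ s t → ⟦ s Sign.* t ⟧sign ≈ ⟦ s ⟧sign * ⟦ t ⟧sign
  sign-homo Sign.+ t      = sym (*-identityˡ _)
  sign-homo Sign.- Sign.+ = sym (*-identityʳ _)
  sign-homo Sign.- Sign.- = begin
    1#               ≈⟨ ⁻¹-involutive _ ⟨
    - - 1#           ≈⟨ -‿cong (-1*x≈-x 1#) ⟨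
    - (- 1# * 1#)    ≈⟨ -‿distribʳ-* _ _ ⟩
    - 1# * - 1#      ∎

  sign-abs : ∀ i → ⟦ i ⟧ℤ ≈ ⟦ ℤ.sign i ⟧sign * ⟦ ℤ.∣ i ∣ ⟧ℕ
  sign-abs i = trans (reflexive (PE.cong ⟦_⟧ℤ (PE.sym (ℤP.◃-inverse i))))
                     (◃-homo (ℤ.sign i) ℤ.∣ i ∣)

  *-homo : ∀ i j → ⟦ i ℤ.* j ⟧ℤ ≈ ⟦ i ⟧ℤ * ⟦ j ⟧ℤ
  *-homo i j = begin
    ⟦ si Sign.* sj ℤ.◃ ai ℕ.* aj ⟧ℤ                 ≈⟨ ◃-homo (si Sign.* sj) (ai ℕ.* aj) ⟩
    ⟦ si Sign.* sj ⟧sign * ⟦ ai ℕ.* aj ⟧ℕ           ≈⟨ *-cong (sign-homo si sj) (×1-homo-* ai aj) ⟩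
    (⟦ si ⟧sign * ⟦ sj ⟧sign) * (⟦ ai ⟧ℕ * ⟦ aj ⟧ℕ) ≈⟨ interchange _ _ _ _ ⟩
    (⟦ si ⟧sign * ⟦ ai ⟧ℕ) * (⟦ sj ⟧sign * ⟦ aj ⟧ℕ) ≈⟨ *-cong (sign-abs i) (sign-abs j) ⟨
    ⟦ i ⟧ℤ * ⟦ j ⟧ℤ                                 ∎
    where
    si = ℤ.sign i
    sj = ℤ.sign j
    ai = ℤ.∣ i ∣
    aj = ℤ.∣ j ∣

  ACR : AlmostCommutativeRing c ℓ
  ACR = fromCommutativeRing R

  ℤ-homomorphism : ℤ.+-*-rawRing -Raw-AlmostCommutative⟶ ACR
  ℤ-homomorphism = record
    { ⟦_⟧ = ⟦_⟧ℤ ; +-homo = +-homo ; *-homo = *-homo ; -‿homo = neg-homo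
    ; 0-homo = refl ; 1-homo = refl }

  coefficient-test : ∀ i j → Maybe (⟦ i ⟧ℤ ≈ ⟦ j ⟧ℤ)
  coefficient-test i j with i ℤ.≟ j
  ... | yes PE.refl = just refl
  ... | no _        = nothing

  open import Algebra.Solver.Ring ℤ.+-*-rawRing ACR ℤ-homomorphism coefficient-test public

  -- the constant polynomial 1, interpreted as 1# on the nose
  :1 : ∀ {k} → Polynomial k
  :1 = con (+ 1)

module Development {cl ℓ : Level} (F : Field cl ℓ) where
  open Field F hiding (zero)
  open FieldDefs F
  open IntegerCoefficients commutativeRing using (solve; _:+_; _:-_; _:*_; :-_; _:=_; :1)
  open import Relation.Binary.Reasoning.Setoid setoid

  inverseˡ : ∀ x → ¬ (x ≈ 0#) → x ⁻¹ * x ≈ 1#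
  inverseˡ x x≉0 = trans (*-comm _ _) (inverseʳ x x≉0)

  *-nonzero : ∀ {x y} → ¬ (x ≈ 0#) → ¬ (y ≈ 0#) → ¬ (x * y ≈ 0#)
  *-nonzero {x} {y} x≉0 y≉0 xy≈0 = y≉0 (begin
    y                ≈⟨ *-identityˡ y ⟨
    1# * y           ≈⟨ *-congʳ (inverseˡ x x≉0) ⟨
    (x ⁻¹ * x) * y   ≈⟨ *-assoc _ _ _ ⟩
    x ⁻¹ * (x * y)   ≈⟨ *-congˡ xy≈0 ⟩
    x ⁻¹ * 0#        ≈⟨ zeroʳ _ ⟩
    0#               ∎)

  solve-for : ∀ {x y z} → ¬ (y ≈ 0#) → x * y ≈ z → x ≈ z * y ⁻¹
  solve-for {x} {y} {z} y≉0 xy≈z = begin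
    x                 ≈⟨ *-identityʳ x ⟨
    x * 1#            ≈⟨ *-congˡ (inverseʳ y y≉0) ⟨
    x * (y * y ⁻¹)    ≈⟨ *-assoc _ _ _ ⟨
    (x * y) * y ⁻¹    ≈⟨ *-congʳ xy≈z ⟩
    z * y ⁻¹          ∎

  inverse-unique : ∀ {x y} → x * y ≈ 1# → x ⁻¹ ≈ y
  inverse-unique {x} {y} xy≈1 = begin
    x ⁻¹               ≈⟨ *-identityʳ _ ⟨
    x ⁻¹ * 1#          ≈⟨ *-congˡ xy≈1 ⟨
    x ⁻¹ * (x * y)     ≈⟨ *-assoc _ _ _ ⟨
    (x ⁻¹ * x) * y     ≈⟨ *-congʳ (inverseˡ x x≉0) ⟩
    1# * y             ≈⟨ *-identityˡ y ⟩
    y                  ∎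
    where
    x≉0 : ¬ (x ≈ 0#)
    x≉0 x≈0 = 0≉1 (begin
      0#       ≈⟨ zeroˡ y ⟨
      0# * y   ≈⟨ *-congʳ x≈0 ⟨
      x * y    ≈⟨ xy≈1 ⟩
      1#       ∎)

  inverse-* : ∀ {x y} → ¬ (x ≈ 0#) → ¬ (y ≈ 0#) → (x * y) ⁻¹ ≈ x ⁻¹ * y ⁻¹
  inverse-* {x} {y} x≉0 y≉0 = inverse-unique (begin
    (x * y) * (x ⁻¹ * y ⁻¹)   ≈⟨ solve 4 (λ x y x' y' → (x :* y) :* (x' :* y') := (x :* x') :* (y :* y'))
                                  refl x y (x ⁻¹) (y ⁻¹) ⟩
    (x * x ⁻¹) * (y * y ⁻¹)   ≈⟨ *-cong (inverseʳ x x≉0) (inverseʳ y y≉0) ⟩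
    1# * 1#                   ≈⟨ *-identityʳ 1# ⟩
    1#                        ∎)

  inverse-neg : ∀ {x} → ¬ (x ≈ 0#) → (- x) ⁻¹ ≈ - (x ⁻¹)
  inverse-neg {x} x≉0 =
    inverse-unique (trans (solve 2 (λ x x' → (:- x) :* (:- x') := x :* x') refl x (x ⁻¹)) (inverseʳ x x≉0))

  ^-+ : ∀ x a b → x ^ (a ℕ.+ b) ≈ x ^ a * x ^ b
  ^-+ x zero    b = sym (*-identityˡ _)
  ^-+ x (suc a) b = trans (*-congˡ (^-+ x a b)) (sym (*-assoc _ _ _))

  ^-distrib-* : ∀ x y n → (x * y) ^ n ≈ x ^ n * y ^ n
  ^-distrib-* x y zero    = sym (*-identityˡ _)
  ^-distrib-* x y (suc n) = trans (*-congˡ (^-distrib-* x y n))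
    (solve 4 (λ x y a b → (x :* y) :* (a :* b) := (x :* a) :* (y :* b)) refl x y (x ^ n) (y ^ n))

  ^-^ : ∀ x a b → (x ^ a) ^ b ≈ x ^ (a ℕ.* b)
  ^-^ x a zero    = reflexive (PE.cong (x ^_) (PE.sym (ℕP.*-zeroʳ a)))
  ^-^ x a (suc b) = begin
    x ^ a * (x ^ a) ^ b        ≈⟨ *-congˡ (^-^ x a b) ⟩
    x ^ a * x ^ (a ℕ.* b)      ≈⟨ ^-+ x a (a ℕ.* b) ⟨
    x ^ (a ℕ.+ a ℕ.* b)        ≡⟨ PE.cong (x ^_) (ℕP.*-suc a b) ⟨
    x ^ (a ℕ.* suc b)          ∎

  ^-swap : ∀ x a b → (x ^ a) ^ b ≈ (x ^ b) ^ a
  ^-swap x a b = trans (^-^ x a b)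
    (trans (reflexive (PE.cong (x ^_) (ℕP.*-comm a b))) (sym (^-^ x b a)))

  -- Sums over the antidiagonal: Σ_{k + r = n} g k r, in increasing order of k.

  antidiag : ℕ → (ℕ → ℕ → Carrier) → Carrier
  antidiag zero    g = g 0 0
  antidiag (suc n) g = g 0 (suc n) + antidiag n (λ k r → g (suc k) r)

  antidiag-cong : ∀ n {g h : ℕ → ℕ → Carrier} →
    (∀ k r → k ℕ.+ r ≡ n → g k r ≈ h k r) → antidiag n g ≈ antidiag n h
  antidiag-cong zero    g≈h = g≈h 0 0 PE.refl
  antidiag-cong (suc n) g≈h =
    +-cong (g≈h 0 (suc n) PE.refl) (antidiag-cong n (λ k r e → g≈h (suc k) r (PE.cong suc e)))

  antidiag-+ : ∀ n (g h : ℕ → ℕ → Carrier) →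
    antidiag n (λ k r → g k r + h k r) ≈ antidiag n g + antidiag n h
  antidiag-+ zero    g h = refl
  antidiag-+ (suc n) g h = trans (+-congˡ (antidiag-+ n _ _))
    (solve 4 (λ a b c d → (a :+ b) :+ (c :+ d) := (a :+ c) :+ (b :+ d)) refl _ _ _ _)

  antidiag-*ˡ : ∀ n (g : ℕ → ℕ → Carrier) x → antidiag n (λ k r → x * g k r) ≈ x * antidiag n g
  antidiag-*ˡ zero    g x = refl
  antidiag-*ˡ (suc n) g x = trans (+-congˡ (antidiag-*ˡ n _ x)) (sym (distribˡ _ _ _))

  antidiag-*ʳ : ∀ n (g : ℕ → ℕ → Carrier) x → antidiag n (λ k r → g k r * x) ≈ antidiag n g * x
  antidiag-*ʳ zero    g x = refl
  antidiag-*ʳ (suc n) g x = trans (+-congˡ (antidiag-*ʳ n _ x)) (sym (distribʳ _ _ _))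

  antidiag-last : ∀ n (g : ℕ → ℕ → Carrier) →
    antidiag (suc n) g ≈ antidiag n (λ k r → g k (suc r)) + g (suc n) 0
  antidiag-last zero    g = refl
  antidiag-last (suc n) g =
    trans (+-congˡ (antidiag-last n (λ k r → g (suc k) r))) (sym (+-assoc _ _ _))

  sumₚ-antidiag : ∀ n (f : ℕ → PS) m l → sumₚ n f m l ≈ antidiag n (λ k _ → f k m l)
  sumₚ-antidiag zero    f m l = refl
  sumₚ-antidiag (suc n) f m l = begin
    sumₚ n f m l + f (suc n) m l                           ≈⟨ +-congʳ (sumₚ-antidiag n f m l) ⟩
    antidiag n (λ k _ → f k m l) + f (suc n) m l           ≈⟨ antidiag-last n (λ k _ → f k m l) ⟨
    antidiag (suc n) (λ k _ → f k m l)                     ∎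

  -- The q-calculus for a fixed base q.
  module Base (q : Carrier) where

    poch-cong : ∀ {x y} r → x ≈ y → poch x q r ≈ poch y q r
    poch-cong zero    x≈y = refl
    poch-cong (suc r) x≈y = *-cong (poch-cong r x≈y) (+-congˡ (-‿cong (*-congʳ x≈y)))

    poch-first : ∀ x r → poch x q (suc r) ≈ (1# - x) * poch (x * q) q r
    poch-first x zero = solve 1 (λ x → :1 :* (:1 :- x :* :1) := (:1 :- x) :* :1) refl x
    poch-first x (suc r) = begin
      poch x q (suc r) * (1# - x * (q * q ^ r))
        ≈⟨ *-cong (poch-first x r) (+-congˡ (-‿cong (sym (*-assoc _ _ _)))) ⟩
      ((1# - x) * poch (x * q) q r) * (1# - (x * q) * q ^ r)   ≈⟨ *-assoc _ _ _ ⟩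
      (1# - x) * (poch (x * q) q r * (1# - (x * q) * q ^ r))   ∎

    poch-+ : ∀ x a b → poch x q (a ℕ.+ b) ≈ poch x q a * poch (x * q ^ a) q b
    poch-+ x a zero = trans (reflexive (PE.cong (poch x q) (ℕP.+-identityʳ a))) (sym (*-identityʳ _))
    poch-+ x a (suc b) = begin
      poch x q (a ℕ.+ suc b)                              ≡⟨ PE.cong (poch x q) (ℕP.+-suc a b) ⟩
      poch x q (a ℕ.+ b) * (1# - x * q ^ (a ℕ.+ b))
        ≈⟨ *-cong (poch-+ x a b)
                  (+-congˡ (-‿cong (trans (*-congˡ (^-+ q a b)) (sym (*-assoc _ _ _))))) ⟩
      (poch x q a * poch (x * q ^ a) q b) * (1# - (x * q ^ a) * q ^ b)  ≈⟨ *-assoc _ _ _ ⟩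
      poch x q a * poch (x * q ^ a) q (suc b)             ∎

    -- The Gaussian coefficient [k+r k], defined by the Pascal recurrence.
    gauss : ℕ → ℕ → Carrier
    gauss zero    r       = 1#
    gauss (suc k) zero    = 1#
    gauss (suc k) (suc r) = q ^ suc k * gauss (suc k) r + gauss k (suc r)

    gauss-r0 : ∀ k → gauss k 0 ≡ 1#
    gauss-r0 zero    = PE.refl
    gauss-r0 (suc k) = PE.refl

    gauss-factorial : ∀ k r → poch q q (k ℕ.+ r) ≈ gauss k r * (poch q q k * poch q q r)
    gauss-factorial zero r = solve 1 (λ x → x := :1 :* (:1 :* x)) refl (poch q q r)
    gauss-factorial (suc k) zero =
      trans (reflexive (PE.cong (λ t → poch q q (suc t)) (ℕP.+-identityʳ k)))
            (solve 1 (λ x → x := :1 :* (x :* :1)) refl (poch q q (suc k)))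
    gauss-factorial (suc k) (suc r) = begin
      X * (1# - q * q ^ (k ℕ.+ suc r))        ≈⟨ *-congˡ (+-congˡ (-‿cong top-power)) ⟩
      X * (1# - A * B)
        ≈⟨ solve 3 (λ A B X → X :* (:1 :- A :* B) := A :* (:1 :- B) :* X :+ (:1 :- A) :* X) refl A B X ⟩
      A * (1# - B) * X + (1# - A) * X
        ≈⟨ +-cong (*-congˡ (trans (reflexive (PE.cong (poch q q) (ℕP.+-suc k r))) (gauss-factorial (suc k) r)))
                  (*-congˡ (gauss-factorial k (suc r))) ⟩
      A * (1# - B) * (G₁ * ((Pk * (1# - A)) * Pr)) + (1# - A) * (G₂ * (Pk * (Pr * (1# - B))))
        ≈⟨ solve 6 (λ A B G₁ G₂ Pk Pr →
              A :* (:1 :- B) :* (G₁ :* ((Pk :* (:1 :- A)) :* Pr)) :+ (:1 :- A) :* (G₂ :* (Pk :* (Pr :* (:1 :- B))))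
              := (A :* G₁ :+ G₂) :* ((Pk :* (:1 :- A)) :* (Pr :* (:1 :- B)))) refl A B G₁ G₂ Pk Pr ⟩
      (A * G₁ + G₂) * ((Pk * (1# - A)) * (Pr * (1# - B)))   ∎
      where
      X = poch q q (k ℕ.+ suc r)
      A = q * q ^ k
      B = q * q ^ r
      G₁ = gauss (suc k) r
      G₂ = gauss k (suc r)
      Pk = poch q q k
      Pr = poch q q r
      top-power : q * q ^ (k ℕ.+ suc r) ≈ A * B
      top-power = trans (*-congˡ (^-+ q k (suc r)))
        (solve 3 (λ q a b → q :* (a :* (q :* b)) := (q :* a) :* (q :* b)) refl q (q ^ k) (q ^ r))

    qbinom≈gauss : (∀ m → ¬ (poch q q m ≈ 0#)) → ∀ {n} k r → k ℕ.+ r ≡ n → qbinom q n k ≈ gauss k r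
    qbinom≈gauss qq≉0 k r PE.refl = sym (solve-for (*-nonzero (qq≉0 k) (qq≉0 (k ℕ.+ r ∸ k))) (begin
      gauss k r * (poch q q k * poch q q (k ℕ.+ r ∸ k))
        ≡⟨ PE.cong (λ t → gauss k r * (poch q q k * poch q q t)) (ℕP.m+n∸m≡n k r) ⟩
      gauss k r * (poch q q k * poch q q r)    ≈⟨ gauss-factorial k r ⟨
      poch q q (k ℕ.+ r)                       ∎))

    -- Pascal summation: the recurrence of gauss, summed over k + r = n+1.
    pascal-sum : ∀ n (f : ℕ → ℕ → Carrier) →
      antidiag (suc n) (λ k r → gauss k r * f k r)
        ≈ antidiag n (λ k r → q ^ k * gauss k r * f k (suc r)) + antidiag n (λ k r → gauss k r * f (suc k) r)
    pascal-sum n f = begin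
      antidiag (suc n) (λ k r → gauss k r * f k r)
        ≈⟨ +-cong first-term (antidiag-cong n (λ k r _ → split k r)) ⟩
      antidiag (suc n) (λ k r → upper k r + lower k r)      ≈⟨ antidiag-+ (suc n) upper lower ⟩
      antidiag (suc n) upper + antidiag (suc n) lower
        ≈⟨ +-cong (trans (antidiag-last n upper) (+-identityʳ _)) (+-identityˡ _) ⟩
      antidiag n (λ k r → q ^ k * gauss k r * f k (suc r)) + antidiag n (λ k r → gauss k r * f (suc k) r) ∎
      where
      -- the two halves of the recurrence, each vanishing on one boundary
      upper : ℕ → ℕ → Carrier
      upper k zero    = 0#
      upper k (suc r) = q ^ k * gauss k r * f k (suc r)
      lower : ℕ → ℕ → Carrier
      lower zero    r = 0#
      lower (suc k) r = gauss k r * f (suc k) r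
      first-term : 1# * f 0 (suc n) ≈ 1# * 1# * f 0 (suc n) + 0#
      first-term = trans (*-congʳ (sym (*-identityʳ 1#))) (sym (+-identityʳ _))
      split : ∀ k r → gauss (suc k) r * f (suc k) r ≈ upper (suc k) r + lower (suc k) r
      split k zero    = trans (sym (+-identityˡ _)) (+-congˡ (*-congʳ (reflexive (PE.sym (gauss-r0 k)))))
      split k (suc r) = distribʳ _ _ _

    -- Summand of the expansion of 1 (identity behind the shift c ↦ c qⁿ).
    unit-term : Carrier → ℕ → ℕ → Carrier
    unit-term z k r = z ^ k * q ^ (2 ℕ.* choose2 k) * poch (z * q ^ k) q r

    q^2choose2-suc : ∀ k → q ^ (2 ℕ.* choose2 (suc k)) ≈ q ^ k * q ^ k * q ^ (2 ℕ.* choose2 k)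
    q^2choose2-suc k = begin
      q ^ (2 ℕ.* (k ℕ.+ choose2 k))              ≡⟨ PE.cong (q ^_) (exponent k (choose2 k)) ⟩
      q ^ (k ℕ.+ (k ℕ.+ 2 ℕ.* choose2 k))        ≈⟨ ^-+ q k _ ⟩
      q ^ k * q ^ (k ℕ.+ 2 ℕ.* choose2 k)        ≈⟨ *-congˡ (^-+ q k _) ⟩
      q ^ k * (q ^ k * q ^ (2 ℕ.* choose2 k))    ≈⟨ *-assoc _ _ _ ⟨
      q ^ k * q ^ k * q ^ (2 ℕ.* choose2 k)      ∎
      where
      exponent : ∀ a b → 2 ℕ.* (a ℕ.+ b) ≡ a ℕ.+ (a ℕ.+ 2 ℕ.* b)
      exponent a b = PE.trans (ℕP.*-distribˡ-+ 2 a b)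
        (PE.trans (PE.cong (ℕ._+ 2 ℕ.* b) (PE.cong (a ℕ.+_) (ℕP.+-identityʳ a))) (ℕP.+-assoc a a (2 ℕ.* b)))

    unit-expansion : ∀ n z → antidiag n (λ k r → gauss k r * unit-term z k r) ≈ 1#
    unit-expansion zero z = solve 0 (:1 :* (:1 :* :1 :* :1) := :1) refl
    unit-expansion (suc n) z = begin
      antidiag (suc n) (λ k r → gauss k r * unit-term z k r)      ≈⟨ pascal-sum n (unit-term z) ⟩
      antidiag n (λ k r → q ^ k * gauss k r * unit-term z k (suc r))
        + antidiag n (λ k r → gauss k r * unit-term z (suc k) r)  ≈⟨ antidiag-+ n _ _ ⟨
      antidiag n (λ k r → q ^ k * gauss k r * unit-term z k (suc r) + gauss k r * unit-term z (suc k) r)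
                                                                  ≈⟨ antidiag-cong n (λ k r _ → merge k r) ⟩
      antidiag n (λ k r → gauss k r * unit-term (z * q) k r)      ≈⟨ unit-expansion n (z * q) ⟩
      1#                                                          ∎
      where
      -- the two Pascal contributions recombine into the summand for z q
      merge : ∀ k r → q ^ k * gauss k r * unit-term z k (suc r) + gauss k r * unit-term z (suc k) r
                        ≈ gauss k r * unit-term (z * q) k r
      merge k r = begin
        q ^ k * gauss k r * (z ^ k * Q₂ * poch (z * q ^ k) q (suc r))
          + gauss k r * (z * z ^ k * q ^ (2 ℕ.* choose2 (suc k)) * poch (z * (q * q ^ k)) q r)
          ≈⟨ +-cong (*-congˡ (*-congˡ (poch-first (z * q ^ k) r)))
                    (*-congˡ (*-cong (*-congˡ (q^2choose2-suc k))
                                     (poch-cong r (solve 3 (λ z q a → z :* (q :* a) := z :* a :* q) refl z q (q ^ k))))) ⟩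
        q ^ k * gauss k r * (z ^ k * Q₂ * ((1# - z * q ^ k) * Y))
          + gauss k r * (z * z ^ k * (q ^ k * q ^ k * Q₂) * Y)
          ≈⟨ solve 6 (λ qk g zk Q₂ Y z →
               qk :* g :* (zk :* Q₂ :* ((:1 :- z :* qk) :* Y)) :+ g :* (z :* zk :* (qk :* qk :* Q₂) :* Y)
               := g :* ((zk :* qk) :* Q₂ :* Y)) refl (q ^ k) (gauss k r) (z ^ k) Q₂ Y z ⟩
        gauss k r * ((z ^ k * q ^ k) * Q₂ * Y)
          ≈⟨ *-congˡ (*-cong (*-congʳ (sym (^-distrib-* z q k)))
                             (poch-cong r (solve 3 (λ z q a → z :* a :* q := z :* q :* a) refl z q (q ^ k)))) ⟩
        gauss k r * unit-term (z * q) k r ∎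
        where
        Q₂ = q ^ (2 ℕ.* choose2 k)
        Y = poch (z * q ^ k * q) q r

    shifted-prod : Carrier → ℕ → Carrier → Carrier
    shifted-prod e zero    w = 1#
    shifted-prod e (suc n) w = (w + e * q ^ suc n) * shifted-prod e n w

    shifted-prod-cong : ∀ {e e'} n w → e ≈ e' → shifted-prod e n w ≈ shifted-prod e' n w
    shifted-prod-cong zero    w e≈e' = refl
    shifted-prod-cong (suc n) w e≈e' = *-cong (+-congˡ (*-congʳ e≈e')) (shifted-prod-cong n w e≈e')

    shifted-prod-first : ∀ e n w → shifted-prod e (suc n) w ≈ (w + e * q) * shifted-prod (e * q) n w
    shifted-prod-first e zero w = *-congʳ (+-congˡ (*-congˡ (*-identityʳ q)))
    shifted-prod-first e (suc n) w = begin
      (w + e * (q * q ^ suc n)) * shifted-prod e (suc n) w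
        ≈⟨ *-cong (+-congˡ (sym (*-assoc _ _ _))) (shifted-prod-first e n w) ⟩
      (w + e * q * q ^ suc n) * ((w + e * q) * shifted-prod (e * q) n w)
        ≈⟨ solve 3 (λ a b c → a :* (b :* c) := b :* (a :* c)) refl _ _ _ ⟩
      (w + e * q) * ((w + e * q * q ^ suc n) * shifted-prod (e * q) n w) ∎

    binomial-term : Carrier → Carrier → ℕ → ℕ → Carrier
    binomial-term e w k r = e ^ r * q ^ choose2 (suc r) * w ^ k

    q-binomial : ∀ e n w → antidiag n (λ k r → gauss k r * binomial-term e w k r) ≈ shifted-prod e n w
    q-binomial e zero w = solve 0 (:1 :* (:1 :* :1 :* :1) := :1) refl
    q-binomial e (suc n) w = begin
      antidiag (suc n) (λ k r → gauss k r * binomial-term e w k r)   ≈⟨ pascal-sum n (binomial-term e w) ⟩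
      antidiag n (λ k r → q ^ k * gauss k r * binomial-term e w k (suc r))
        + antidiag n (λ k r → gauss k r * binomial-term e w (suc k) r)
        ≈⟨ +-cong (antidiag-cong n raise-r) (antidiag-cong n (λ k r _ → raise-k k r)) ⟩
      antidiag n (λ k r → E * (gauss k r * binomial-term e w k r))
        + antidiag n (λ k r → w * (gauss k r * binomial-term e w k r))
        ≈⟨ +-cong (antidiag-*ˡ n _ E) (antidiag-*ˡ n _ w) ⟩
      E * antidiag n (λ k r → gauss k r * binomial-term e w k r)
        + w * antidiag n (λ k r → gauss k r * binomial-term e w k r)
        ≈⟨ +-cong (*-congˡ (q-binomial e n w)) (*-congˡ (q-binomial e n w)) ⟩
      E * shifted-prod e n w + w * shifted-prod e n w
        ≈⟨ trans (sym (distribʳ _ _ _)) (*-congʳ (+-comm _ _)) ⟩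
      (w + E) * shifted-prod e n w                                   ∎
      where
      E = e * q ^ suc n
      raise-r : ∀ k r → k ℕ.+ r ≡ n →
        q ^ k * gauss k r * binomial-term e w k (suc r) ≈ E * (gauss k r * binomial-term e w k r)
      raise-r k r k+r≡n = begin
        q ^ k * gauss k r * (e * e ^ r * q ^ (suc r ℕ.+ choose2 (suc r)) * w ^ k)
          ≈⟨ *-congˡ (*-congʳ (*-congˡ (^-+ q (suc r) (choose2 (suc r))))) ⟩
        q ^ k * gauss k r * (e * e ^ r * (q ^ suc r * q ^ choose2 (suc r)) * w ^ k)
          ≈⟨ solve 7 (λ qk g e er qs qc wk →
               qk :* g :* (e :* er :* (qs :* qc) :* wk) := e :* (qk :* qs) :* (g :* (er :* qc :* wk)))
               refl (q ^ k) (gauss k r) e (e ^ r) (q ^ suc r) (q ^ choose2 (suc r)) (w ^ k) ⟩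
        e * (q ^ k * q ^ suc r) * (gauss k r * binomial-term e w k r)
          ≈⟨ *-congʳ (*-congˡ (trans (sym (^-+ q k (suc r)))
                (reflexive (PE.cong (q ^_) (PE.trans (ℕP.+-suc k r) (PE.cong suc k+r≡n)))))) ⟩
        E * (gauss k r * binomial-term e w k r) ∎
      raise-k : ∀ k r → gauss k r * binomial-term e w (suc k) r ≈ w * (gauss k r * binomial-term e w k r)
      raise-k k r = solve 5 (λ g a b w wk → g :* (a :* b :* (w :* wk)) := w :* (g :* (a :* b :* wk)))
                      refl (gauss k r) (e ^ r) (q ^ choose2 (suc r)) w (w ^ k)

    module Reflection (q≉0 : ¬ (q ≈ 0#)) where
      p = q ⁻¹

      q*p≈1 : q * p ≈ 1#
      q*p≈1 = inverseʳ q q≉0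

      p≉0 : ¬ (p ≈ 0#)
      p≉0 p≈0 = 0≉1 (trans (sym (zeroʳ q)) (trans (*-congˡ (sym p≈0)) q*p≈1))

      inverse-/q : ∀ {c} → ¬ (c ≈ 0#) → (c * p) ⁻¹ ≈ c ⁻¹ * q
      inverse-/q {c} c≉0 = inverse-unique (begin
        c * p * (c ⁻¹ * q)       ≈⟨ solve 4 (λ c p c' q → c :* p :* (c' :* q) := (c :* c') :* (q :* p)) refl c p (c ⁻¹) q ⟩
        (c * c ⁻¹) * (q * p)     ≈⟨ *-cong (inverseʳ c c≉0) q*p≈1 ⟩
        1# * 1#                  ≈⟨ *-identityʳ 1# ⟩
        1#                       ∎)

      -- one step: (c;q)ₘ (1 - q/c) = (qᵐ - q/c) (c/q;q)ₘ.  The relations q p = 1 and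
      -- c c⁻¹ = 1, unknown to the ring solver, enter as vanishing correction terms.
      reflection-step : ∀ c → ¬ (c ≈ 0#) → ∀ m →
        poch c q m * (1# - q * c ⁻¹) ≈ (q ^ m - c ⁻¹ * q) * poch (c * p) q m
      reflection-step c c≉0 zero =
        solve 2 (λ q ci → :1 :* (:1 :- q :* ci) := (:1 :- ci :* q) :* :1) refl q (c ⁻¹)
      reflection-step c c≉0 (suc m) = begin
        poch c q m * (1# - c * X) * (1# - q * ci)
          ≈⟨ solve 3 (λ a b d → a :* b :* d := a :* d :* b) refl _ _ _ ⟩
        poch c q m * (1# - q * ci) * (1# - c * X)     ≈⟨ *-congʳ (reflection-step c c≉0 m) ⟩
        (X - ci * q) * Y * (1# - c * X)
          ≈⟨ sym (trans (+-congˡ (trans (*-congˡ (+-cong (*-congʳ (sub-one q*p≈1)) (*-congʳ (sub-one (inverseʳ c c≉0)))))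
                                        (trans (*-congˡ (trans (+-cong (zeroˡ _) (zeroˡ _)) (+-identityʳ 0#))) (zeroʳ Y))))
                        (+-identityʳ _)) ⟩
        (X - ci * q) * Y * (1# - c * X) + Y * ((q * p - 1#) * (X - c * X * X) + (c * ci - 1#) * (q * p * X - q * X))
          ≈⟨ solve 6 (λ X ci q c p Y →
               (X :- ci :* q) :* Y :* (:1 :- c :* X) :+ Y :* ((q :* p :- :1) :* (X :- c :* X :* X) :+ (c :* ci :- :1) :* (q :* p :* X :- q :* X))
               := (q :* X :- ci :* q) :* (Y :* (:1 :- c :* p :* X))) refl X ci q c p Y ⟩
        (q * X - ci * q) * (Y * (1# - c * p * X))     ∎
        where
        X = q ^ m
        ci = c ⁻¹
        Y = poch (c * p) q m
        sub-one : ∀ {s} → s ≈ 1# → s - 1# ≈ 0#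
        sub-one s≈1 = trans (+-congʳ s≈1) (-‿inverseʳ 1#)

      reflection : ∀ m n c → ¬ (c ≈ 0#) →
        poch c q m * poch (q * c ⁻¹) q n ≈ poch (c * (p ^ n)) q m * shifted-prod ((- c) ⁻¹) n (q ^ m)
      reflection m zero c c≉0 = *-congʳ (poch-cong m (sym (*-identityʳ c)))
      reflection m (suc n) c c≉0 = begin
        poch c q m * poch (q * ci) q (suc n)                  ≈⟨ *-congˡ (poch-first (q * ci) n) ⟩
        poch c q m * ((1# - q * ci) * poch (q * ci * q) q n)  ≈⟨ *-assoc _ _ _ ⟨
        poch c q m * (1# - q * ci) * poch (q * ci * q) q n    ≈⟨ *-congʳ (reflection-step c c≉0 m) ⟩
        (X - ci * q) * Y * poch (q * ci * q) q n              ≈⟨ *-assoc _ _ _ ⟩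
        (X - ci * q) * (Y * poch (q * ci * q) q n)            ≈⟨ *-congˡ (*-congˡ (poch-cong n shift-base)) ⟩
        (X - ci * q) * (Y * poch (q * (c * p) ⁻¹) q n)        ≈⟨ *-congˡ (reflection m n (c * p) (*-nonzero c≉0 p≉0)) ⟩
        (X - ci * q) * (poch (c * p * (p ^ n)) q m * shifted-prod ((- (c * p)) ⁻¹) n X)
          ≈⟨ *-cong (+-congˡ neg-ci*q) (*-cong (poch-cong m (*-assoc _ _ _)) (shifted-prod-cong n X neg-cp⁻¹)) ⟩
        (X + e * q) * (poch (c * (p ^ suc n)) q m * shifted-prod (e * q) n X)
          ≈⟨ solve 3 (λ a b d → a :* (b :* d) := b :* (a :* d)) refl _ _ _ ⟩
        poch (c * (p ^ suc n)) q m * ((X + e * q) * shifted-prod (e * q) n X)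
          ≈⟨ *-congˡ (shifted-prod-first e n X) ⟨
        poch (c * (p ^ suc n)) q m * shifted-prod e (suc n) X ∎
        where
        X = q ^ m
        ci = c ⁻¹
        e = (- c) ⁻¹
        Y = poch (c * p) q m
        e≈-ci : e ≈ - ci
        e≈-ci = inverse-neg c≉0
        shift-base : q * ci * q ≈ q * (c * p) ⁻¹
        shift-base = trans (*-assoc _ _ _) (*-congˡ (sym (inverse-/q c≉0)))
        neg-ci*q : - (ci * q) ≈ e * q
        neg-ci*q = trans (solve 2 (λ ci q → :- (ci :* q) := (:- ci) :* q) refl ci q) (*-congʳ (sym e≈-ci))
        neg-cp⁻¹ : (- (c * p)) ⁻¹ ≈ e * q
        neg-cp⁻¹ = begin
          (- (c * p)) ⁻¹   ≈⟨ inverse-neg (*-nonzero c≉0 p≉0) ⟩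
          - ((c * p) ⁻¹)   ≈⟨ -‿cong (inverse-/q c≉0) ⟩
          - (ci * q)       ≈⟨ neg-ci*q ⟩
          e * q            ∎

  n∸k≡r : ∀ {n} k r → k ℕ.+ r ≡ n → n ∸ k ≡ r
  n∸k≡r k r k+r≡n = PE.trans (PE.cong (_∸ k) (PE.sym k+r≡n)) (ℕP.m+n∸m≡n k r)

  n+1∸k≡1+r : ∀ {n} k r → k ℕ.+ r ≡ n → n ℕ.+ 1 ∸ k ≡ suc r
  n+1∸k≡1+r k r k+r≡n = PE.trans (PE.cong (λ t → t ℕ.+ 1 ∸ k) (PE.sym k+r≡n))
    (PE.trans (PE.cong (_∸ k) (ℕP.+-assoc k r 1))
      (PE.trans (ℕP.m+n∸m≡n k (r ℕ.+ 1)) (ℕP.+-comm r 1)))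

  k≤n : ∀ {n} k r → k ℕ.+ r ≡ n → k ≤ n
  k≤n k r k+r≡n = PE.subst (k ≤_) k+r≡n (ℕP.m≤m+n k r)

  -- Coefficients of Φ⁽²⁾: the part W(m,l) that does not depend on c.
  Φ2-rest : (q a b b' c' : Carrier) → ℕ → ℕ → Carrier
  Φ2-rest q a b b' c' m l =
    (poch a q (m ℕ.+ l) * poch b q m * poch b' q l) * (poch q q m * poch q q l * poch c' q l) ⁻¹

  Φ2-factor : ∀ q a b b' c₁ c' m l →
    ¬ (poch q q m ≈ 0#) → ¬ (poch q q l ≈ 0#) → ¬ (poch c' q l ≈ 0#) → ¬ (poch c₁ q m ≈ 0#) →
    Φ2 q a b b' c₁ c' m l ≈ Φ2-rest q a b b' c' m l * poch c₁ q m ⁻¹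
  Φ2-factor q a b b' c₁ c' m l qm≉0 ql≉0 cl≉0 pc≉0 = begin
    N * (Qm * Ql * Pc * Cl) ⁻¹          ≈⟨ *-congˡ (⁻¹-cong (solve 4 (λ a b c d → a :* b :* c :* d := a :* b :* d :* c)
                                              refl Qm Ql Pc Cl)) ⟩
    N * (Qm * Ql * Cl * Pc) ⁻¹          ≈⟨ *-congˡ (inverse-* (*-nonzero (*-nonzero qm≉0 ql≉0) cl≉0) pc≉0) ⟩
    N * ((Qm * Ql * Cl) ⁻¹ * Pc ⁻¹)     ≈⟨ *-assoc _ _ _ ⟨
    N * (Qm * Ql * Cl) ⁻¹ * Pc ⁻¹       ∎
    where
    N = poch a q (m ℕ.+ l) * poch b q m * poch b' q l
    Qm = poch q q m
    Ql = poch q q l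
    Cl = poch c' q l
    Pc = poch c₁ q m

  dilated-sum : ∀ q a b b' c' (cs : ℕ → Carrier) (s : ℕ → Carrier) n m l →
    (∀ m → ¬ (poch q q m ≈ 0#)) → (∀ m → ¬ (poch c' q m ≈ 0#)) →
    (∀ k → k ≤ n → ¬ (poch (cs k) q m ≈ 0#)) →
    sumₚ n (λ k → s k ·ₚ scaleX (q ^ k) (Φ2 q a b b' (cs k) c')) m l
      ≈ antidiag n (λ k _ → s k * (q ^ k) ^ m * poch (cs k) q m ⁻¹) * Φ2-rest q a b b' c' m l
  dilated-sum q a b b' c' cs s n m l qq≉0 c'≉0 cs≉0 = begin
    sumₚ n (λ k → s k ·ₚ scaleX (q ^ k) (Φ2 q a b b' (cs k) c')) m l
      ≈⟨ sumₚ-antidiag n _ m l ⟩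
    antidiag n (λ k _ → s k * ((q ^ k) ^ m * Φ2 q a b b' (cs k) c' m l))
      ≈⟨ antidiag-cong n term ⟩
    antidiag n (λ k _ → s k * (q ^ k) ^ m * poch (cs k) q m ⁻¹ * W)
      ≈⟨ antidiag-*ʳ n _ W ⟩
    antidiag n (λ k _ → s k * (q ^ k) ^ m * poch (cs k) q m ⁻¹) * W ∎
    where
    W = Φ2-rest q a b b' c' m l
    term : ∀ k r → k ℕ.+ r ≡ n →
      s k * ((q ^ k) ^ m * Φ2 q a b b' (cs k) c' m l) ≈ s k * (q ^ k) ^ m * poch (cs k) q m ⁻¹ * W
    term k r k+r≡n = begin
      s k * ((q ^ k) ^ m * Φ2 q a b b' (cs k) c' m l)
        ≈⟨ *-congˡ (*-congˡ (Φ2-factor q a b b' (cs k) c' m l (qq≉0 m) (qq≉0 l) (c'≉0 l)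
                               (cs≉0 k (k≤n k r k+r≡n)))) ⟩
      s k * ((q ^ k) ^ m * (W * poch (cs k) q m ⁻¹))
        ≈⟨ solve 4 (λ s x w i → s :* (x :* (w :* i)) := s :* x :* i :* w) refl (s k) ((q ^ k) ^ m) W _ ⟩
      s k * (q ^ k) ^ m * poch (cs k) q m ⁻¹ * W ∎

  module UpShift (q c : Carrier) (n m : ℕ)
                 (qq≉0 : ∀ m → ¬ (poch q q m ≈ 0#))
                 (cqᵏ≉0 : ∀ k m → k ≤ n → ¬ (poch (c * (q ^ k)) q m ≈ 0#)) where
    open Base q

    z : Carrier
    z = c * q ^ m

    Pn : Carrier
    Pn = poch (c * q ^ n) q m

    coefficient : ℕ → Carrier
    coefficient k = qbinom q n k * (c ^ k) * (q ^ (2 ℕ.* choose2 k)) * poch (c * (q ^ k)) q (n ∸ k)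

    -- (c qᵏ;q)_r (c qⁿ;q)ₘ = (c qᵏ;q)_{r+m} = (c qᵏ;q)ₘ (z qᵏ;q)_r   when k + r = n
    exchange : ∀ k r → k ℕ.+ r ≡ n →
      poch (c * q ^ k) q r * Pn ≈ poch (z * q ^ k) q r * poch (c * q ^ k) q m
    exchange k r k+r≡n = begin
      poch x q r * Pn                      ≈⟨ *-congˡ (poch-cong m top) ⟨
      poch x q r * poch (x * q ^ r) q m    ≈⟨ poch-+ x r m ⟨
      poch x q (r ℕ.+ m)                   ≡⟨ PE.cong (poch x q) (ℕP.+-comm r m) ⟩
      poch x q (m ℕ.+ r)                   ≈⟨ poch-+ x m r ⟩
      poch x q m * poch (x * q ^ m) q r    ≈⟨ *-comm _ _ ⟩
      poch (x * q ^ m) q r * poch x q m    ≈⟨ *-congʳ (poch-cong r (solve 3 (λ c a b → c :* a :* b := c :* b :* a)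
                                                                          refl c (q ^ k) (q ^ m))) ⟩
      poch (z * q ^ k) q r * poch x q m    ∎
      where
      x = c * q ^ k
      top : x * q ^ r ≈ c * q ^ n
      top = trans (*-assoc _ _ _) (*-congˡ (trans (sym (^-+ q k r)) (reflexive (PE.cong (q ^_) k+r≡n))))

    summand : ∀ k r → k ℕ.+ r ≡ n →
      coefficient k * (q ^ k) ^ m * poch (c * q ^ k) q m ⁻¹ ≈ gauss k r * unit-term z k r * Pn ⁻¹
    summand k r k+r≡n = begin
      coefficient k * X * Pk ⁻¹                 ≈⟨ *-congʳ (*-congʳ (*-cong (*-congʳ (*-congʳ (qbinom≈gauss qq≉0 k r k+r≡n)))
                                                                           (reflexive (PE.cong (poch x q) (n∸k≡r k r k+r≡n))))) ⟩
      G * c ^ k * Q₂ * Pa * X * Pk ⁻¹           ≈⟨ solve-for (cqᵏ≉0 n m ℕP.≤-refl) cleared ⟩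
      G * unit-term z k r * Pn ⁻¹               ∎
      where
      G = gauss k r
      x = c * q ^ k
      X = (q ^ k) ^ m
      Q₂ = q ^ (2 ℕ.* choose2 k)
      Pa = poch x q r
      Pk = poch x q m
      Y = poch (z * q ^ k) q r
      powers : c ^ k * X ≈ z ^ k
      powers = trans (*-congˡ (^-swap q k m)) (sym (^-distrib-* c (q ^ m) k))
      cleared : G * c ^ k * Q₂ * Pa * X * Pk ⁻¹ * Pn ≈ G * unit-term z k r
      cleared = begin
        G * c ^ k * Q₂ * Pa * X * Pk ⁻¹ * Pn
          ≈⟨ solve 7 (λ g ck q₂ pa x pk' pn → g :* ck :* q₂ :* pa :* x :* pk' :* pn
                                             := g :* (ck :* x) :* q₂ :* (pa :* pn) :* pk')
               refl G (c ^ k) Q₂ Pa X (Pk ⁻¹) Pn ⟩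
        G * (c ^ k * X) * Q₂ * (Pa * Pn) * Pk ⁻¹
          ≈⟨ *-congʳ (*-cong (*-congʳ (*-congˡ powers)) (exchange k r k+r≡n)) ⟩
        G * z ^ k * Q₂ * (Y * Pk) * Pk ⁻¹
          ≈⟨ solve 6 (λ g zk q₂ y pk pk' → g :* zk :* q₂ :* (y :* pk) :* pk' := g :* (zk :* q₂ :* y) :* (pk :* pk'))
               refl G (z ^ k) Q₂ Y Pk (Pk ⁻¹) ⟩
        G * unit-term z k r * (Pk * Pk ⁻¹)
          ≈⟨ *-congˡ (inverseʳ Pk (cqᵏ≉0 k m (k≤n k r k+r≡n))) ⟩
        G * unit-term z k r * 1#
          ≈⟨ *-identityʳ _ ⟩
        G * unit-term z k r ∎

    up-shift-sum : antidiag n (λ k _ → coefficient k * (q ^ k) ^ m * poch (c * q ^ k) q m ⁻¹) ≈ Pn ⁻¹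
    up-shift-sum = begin
      antidiag n (λ k _ → coefficient k * (q ^ k) ^ m * poch (c * q ^ k) q m ⁻¹)
        ≈⟨ antidiag-cong n summand ⟩
      antidiag n (λ k r → gauss k r * unit-term z k r * Pn ⁻¹)
        ≈⟨ antidiag-*ʳ n _ (Pn ⁻¹) ⟩
      antidiag n (λ k r → gauss k r * unit-term z k r) * Pn ⁻¹
        ≈⟨ *-congʳ (unit-expansion n z) ⟩
      1# * Pn ⁻¹
        ≈⟨ *-identityˡ _ ⟩
      Pn ⁻¹ ∎

  module DownShift (q c : Carrier) (n m : ℕ)
                   (qq≉0 : ∀ m → ¬ (poch q q m ≈ 0#))
                   (q≉0 : ¬ (q ≈ 0#)) (c≉0 : ¬ (c ≈ 0#))
                   (Pc≉0 : ¬ (poch c q m ≈ 0#)) (D≉0 : ¬ (poch (q / c) q n ≈ 0#)) where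
    open Base q
    open Reflection q≉0

    e : Carrier
    e = (- c) ⁻¹

    coefficient : ℕ → Carrier
    coefficient k = qbinom q n k * (e ^ (n ∸ k)) * (q ^ choose2 (n ℕ.+ 1 ∸ k))

    Pc Pn D : Carrier
    Pc = poch c q m
    Pn = poch (c * ((q ⁻¹) ^ n)) q m
    D = poch (q / c) q n

    binomial-sum : antidiag n (λ k _ → coefficient k * (q ^ k) ^ m) ≈ shifted-prod e n (q ^ m)
    binomial-sum = trans (antidiag-cong n summand) (q-binomial e n (q ^ m))
      where
      summand : ∀ k r → k ℕ.+ r ≡ n →
        coefficient k * (q ^ k) ^ m ≈ gauss k r * binomial-term e (q ^ m) k r
      summand k r k+r≡n = begin
        qbinom q n k * e ^ (n ∸ k) * q ^ choose2 (n ℕ.+ 1 ∸ k) * (q ^ k) ^ m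
          ≈⟨ *-cong (*-cong (*-congʳ (qbinom≈gauss qq≉0 k r k+r≡n))
                            (reflexive (PE.cong (λ t → q ^ choose2 t) (n+1∸k≡1+r k r k+r≡n))))
                    (^-swap q k m) ⟩
        gauss k r * e ^ (n ∸ k) * q ^ choose2 (suc r) * (q ^ m) ^ k
          ≡⟨ PE.cong (λ t → gauss k r * e ^ t * q ^ choose2 (suc r) * (q ^ m) ^ k) (n∸k≡r k r k+r≡n) ⟩
        gauss k r * e ^ r * q ^ choose2 (suc r) * (q ^ m) ^ k
          ≈⟨ solve 4 (λ g a b w → g :* a :* b :* w := g :* (a :* b :* w)) refl
               (gauss k r) (e ^ r) (q ^ choose2 (suc r)) ((q ^ m) ^ k) ⟩
        gauss k r * binomial-term e (q ^ m) k r ∎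

    lowered-inverse : Pn ⁻¹ ≈ D ⁻¹ * (shifted-prod e n (q ^ m) * Pc ⁻¹)
    lowered-inverse = inverse-unique (begin
      Pn * (D ⁻¹ * (Π * Pc ⁻¹))    ≈⟨ solve 4 (λ pn d' π pc' → pn :* (d' :* (π :* pc')) := d' :* (pn :* π) :* pc')
                                         refl Pn (D ⁻¹) Π (Pc ⁻¹) ⟩
      D ⁻¹ * (Pn * Π) * Pc ⁻¹      ≈⟨ *-congʳ (*-congˡ (reflection m n c c≉0)) ⟨
      D ⁻¹ * (Pc * D) * Pc ⁻¹      ≈⟨ solve 4 (λ d' pc d pc' → d' :* (pc :* d) :* pc' := (d :* d') :* (pc :* pc'))
                                         refl (D ⁻¹) Pc D (Pc ⁻¹) ⟩
      (D * D ⁻¹) * (Pc * Pc ⁻¹)    ≈⟨ *-cong (inverseʳ D D≉0) (inverseʳ Pc Pc≉0) ⟩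
      1# * 1#                      ≈⟨ *-identityʳ 1# ⟩
      1#                           ∎)
      where
      Π = shifted-prod e n (q ^ m)

    down-shift-sum : Pn ⁻¹ ≈ (1# / D) * antidiag n (λ k _ → coefficient k * (q ^ k) ^ m * Pc ⁻¹)
    down-shift-sum = begin
      Pn ⁻¹                                                         ≈⟨ lowered-inverse ⟩
      D ⁻¹ * (shifted-prod e n (q ^ m) * Pc ⁻¹)                     ≈⟨ *-cong (*-identityˡ _) (*-congʳ binomial-sum) ⟨
      1# * D ⁻¹ * (antidiag n (λ k _ → coefficient k * (q ^ k) ^ m) * Pc ⁻¹)
                                                                    ≈⟨ *-congˡ (antidiag-*ʳ n _ (Pc ⁻¹)) ⟨
      (1# / D) * antidiag n (λ k _ → coefficient k * (q ^ k) ^ m * Pc ⁻¹) ∎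

  down-shift : ∀ q a b b' c c' n →
    (∀ m → ¬ (poch q q m ≈ 0#)) → (∀ m → ¬ (poch c' q m ≈ 0#)) →
    ¬ (q ≈ 0#) → ¬ (c ≈ 0#) →
    (∀ m → ¬ (poch (c * ((q ⁻¹) ^ n)) q m ≈ 0#)) →
    (∀ m → ¬ (poch c q m ≈ 0#)) →
    ¬ (poch (q / c) q n ≈ 0#) →
    Φ2 q a b b' (c * ((q ⁻¹) ^ n)) c'
      ≈ₚ ((1# / poch (q / c) q n) ·ₚ
          sumₚ n (λ k →
            (qbinom q n k * (((- c) ⁻¹) ^ (n ∸ k)) * (q ^ choose2 (n ℕ.+ 1 ∸ k)))
              ·ₚ scaleX (q ^ k) (Φ2 q a b b' c c')))
  down-shift q a b b' c c' n qq≉0 c'≉0 q≉0 c≉0 Pn≉0 Pc≉0 D≉0 m l = begin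
    Φ2 q a b b' (c * ((q ⁻¹) ^ n)) c' m l             ≈⟨ Φ2-factor q a b b' _ c' m l (qq≉0 m) (qq≉0 l) (c'≉0 l) (Pn≉0 m) ⟩
    W * Pn ⁻¹                                         ≈⟨ *-comm _ _ ⟩
    Pn ⁻¹ * W                                         ≈⟨ *-congʳ down-shift-sum ⟩
    (1# / D) * antidiag n (λ k _ → coefficient k * (q ^ k) ^ m * Pc ⁻¹) * W
                                                      ≈⟨ *-assoc _ _ _ ⟩
    (1# / D) * (antidiag n (λ k _ → coefficient k * (q ^ k) ^ m * Pc ⁻¹) * W)
      ≈⟨ *-congˡ (dilated-sum q a b b' c' (λ _ → c) coefficient n m l qq≉0 c'≉0 (λ _ _ → Pc≉0 m)) ⟨
    ((1# / D) ·ₚ sumₚ n (λ k → coefficient k ·ₚ scaleX (q ^ k) (Φ2 q a b b' c c'))) m l ∎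
    where
    open DownShift q c n m qq≉0 q≉0 c≉0 (Pc≉0 m) D≉0
    W = Φ2-rest q a b b' c' m l

  up-shift : ∀ q a b b' c c' n →
    (∀ m → ¬ (poch q q m ≈ 0#)) → (∀ m → ¬ (poch c' q m ≈ 0#)) →
    (∀ k m → k ≤ n → ¬ (poch (c * (q ^ k)) q m ≈ 0#)) →
    Φ2 q a b b' (c * (q ^ n)) c'
      ≈ₚ sumₚ n (λ k →
            (qbinom q n k * (c ^ k) * (q ^ (2 ℕ.* choose2 k)) * poch (c * (q ^ k)) q (n ∸ k))
              ·ₚ scaleX (q ^ k) (Φ2 q a b b' (c * (q ^ k)) c'))
  up-shift q a b b' c c' n qq≉0 c'≉0 cqᵏ≉0 m l = begin
    Φ2 q a b b' (c * q ^ n) c' m l                    ≈⟨ Φ2-factor q a b b' _ c' m l (qq≉0 m) (qq≉0 l) (c'≉0 l) (cqᵏ≉0 n m ℕP.≤-refl) ⟩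
    W * Pn ⁻¹                                         ≈⟨ *-comm _ _ ⟩
    Pn ⁻¹ * W                                         ≈⟨ *-congʳ up-shift-sum ⟨
    antidiag n (λ k _ → coefficient k * (q ^ k) ^ m * poch (c * q ^ k) q m ⁻¹) * W
      ≈⟨ dilated-sum q a b b' c' (λ k → c * q ^ k) coefficient n m l qq≉0 c'≉0 (λ k → cqᵏ≉0 k m) ⟨
    sumₚ n (λ k → coefficient k ·ₚ scaleX (q ^ k) (Φ2 q a b b' (c * q ^ k) c')) m l ∎
    where
    open UpShift q c n m qq≉0 cqᵏ≉0
    W = Φ2-rest q a b b' c' m l

theorem10 : {cl ℓ : Level} (F : Field cl ℓ) →
  let open Field F
      open FieldDefs F
  in (q a b b' c c' : Carrier) (n : ℕ) → 1 ≤ n →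
     -- genericity common to both identities: denominators (q;q)_m, (c';q)_m nonzero
     (∀ m → ¬ (poch q q m ≈ 0#)) →
     (∀ m → ¬ (poch c' q m ≈ 0#)) →
     -- first identity
     ((¬ (q ≈ 0#)) → (¬ (c ≈ 0#)) →
      (∀ m → ¬ (poch (c * ((q ⁻¹) ^ n)) q m ≈ 0#)) →
      (∀ m → ¬ (poch c q m ≈ 0#)) →
      ¬ (poch (q / c) q n ≈ 0#) →
      Φ2 q a b b' (c * ((q ⁻¹) ^ n)) c'
        ≈ₚ ((1# / poch (q / c) q n) ·ₚ
            sumₚ n (λ k →
              (qbinom q n k * (((- c) ⁻¹) ^ (n ∸ k)) * (q ^ choose2 (n +ℕ 1 ∸ k)))
                ·ₚ scaleX (q ^ k) (Φ2 q a b b' c c'))))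
     ×
     -- second identity
     ((∀ k m → k ≤ n → ¬ (poch (c * (q ^ k)) q m ≈ 0#)) →
      Φ2 q a b b' (c * (q ^ n)) c'
        ≈ₚ sumₚ n (λ k →
              (qbinom q n k * (c ^ k) * (q ^ (2 *ℕ choose2 k)) * poch (c * (q ^ k)) q (n ∸ k))
                ·ₚ scaleX (q ^ k) (Φ2 q a b b' (c * (q ^ k)) c')))
theorem10 F q a b b' c c' n _ qq≉0 c'≉0 =
  down-shift q a b b' c c' n qq≉0 c'≉0 , up-shift q a b b' c c' n qq≉0 c'≉0
  where open Development F
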